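{- Let $k,e\ge 0$ be integers and let $p$ be a prime with $p^e\le k+1<p^{e+1}$. Then for every integer $r\ge 1$: (i) for nonnegative integers $d,d'$, if $d\equiv d' \pmod{p^{e+r}}$ then $\binom{d}{k+1}\equiv\binom{d'}{k+1}\pmod{p^r}$; (ii) for all $i=0,1,\dots,p^{e+r}+k$, $\binom{p^{e+r}+k-i}{k+1}\equiv(-1)^{k+1}\binom{i}{k+1}\pmod{p^r}$; (iii) $\binom{d}{k+1}\equiv 0\pmod{p^r}$ for all $p^{e+r}\le d\le p^{e+r}+k$, and this is the unique longest run of zeros in the period: if $d\ge k+1$ and $\binom{d+i}{k+1}\equiv 0\pmod{p^r}$ for all $i=0,\dots,k$, then $p^{e+r}$ divides $d$, and there is no run of more than $k+1$ consecutive integers $d$ with $\binom{d}{k+1}\equiv 0\pmod{p^r}$.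
   Context: Binomial coefficients satisfy $\binom{a}{b}=0$ when $0\le a<b$. -}

module Defs where

open import Data.Nat using (ℕ)
open import Data.Integer using (ℤ; _-_)
open import Data.Integer.Divisibility using (_∣_)

_≡_[mod_] : ℤ → ℤ → ℕ → Set
a ≡ b [mod m ] = Data.Integer.+ m ∣ (a - b)
  where import Data.Integer

-- Write K = k + 1 and M = p^(e+r).  For 0 < j ≤ K the absorption identity
-- j C(M, j) = M C(M-1, j-1) together with p^(e+1) ∤ j gives p^r ∣ C(M, j), so by Pascal's
-- rule the rows n and n + M of Pascal's triangle agree modulo p^r up to column K; the
-- same Pascal induction yields the reflection i ↦ M + k - i.  Conversely, if C(d + i, K)
-- vanishes modulo p^r for i = 0, …, k, taking differences gives C(d, j) ≡ 0 for all
-- 1 ≤ j ≤ K.  Since C(w p^a, p^a) = w C(w p^a - 1, p^a - 1) and the last factor is ≡ ±1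
-- modulo p, the zeros at j = 1, p, …, p^e successively force p^(1+r), …, p^(e+r) to
-- divide d.  A run of K + 1 zeros would make M divide both d and d + 1.
module Submission where

open import Defs
open import Data.Nat
  using (ℕ; zero; suc; _+_; _*_; _^_; _≤_; _<_; _∸_; pred; z≤n; s≤s; _≤′_; ≤′-refl; ≤′-step;
         NonZero; nonTrivial⇒≢1)
open import Data.Nat.Properties
open import Data.Nat.Divisibility
  using (divides; _∤_; _∣?_; _∣0; 1∣_; ∣1⇒≡1; >⇒∤; ∣-refl; ∣-trans; m∣m*n; ∣m⇒∣m*n;
         *-monoʳ-∣; *-cancelˡ-∣; *-cancelʳ-∣; ∣m+n∣m⇒∣n)
  renaming (_∣_ to _∣ℕ_)
open import Data.Nat.Combinatorics using (_C_; nCk+nC[k+1]≡[n+1]C[k+1])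
open import Data.Nat.Primality using (Prime; prime⇒nonZero; prime⇒nonTrivial; euclidsLemma)
open import Data.Nat.Tactic.RingSolver using (solve-∀)
open import Data.Integer as ℤ using (ℤ; +_; -_; _-_)
open import Data.Integer using () renaming (_^_ to _^ℤ_; _*_ to _*ℤ_)
import Data.Integer.Properties as ℤ
import Data.Integer.Divisibility.Signed as ℤ
import Data.Integer.Tactic.RingSolver as ℤ-Ring
open import Data.Product using (_×_; _,_)
open import Data.Sum using (inj₁; inj₂)
open import Relation.Nullary using (¬_; yes; no; contradiction)
open import Relation.Binary.PropositionalEquality
open import Relation.Binary.Bundles using (Setoid)
open import Relation.Binary.Structures using (IsEquivalence)

infixl 6.5 _choose_

-- Pascal's recursion: unlike the library's `_C_`, this computes by structural recursion.
_choose_ : ℕ → ℕ → ℕ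
n     choose zero  = 1
zero  choose suc k = 0
suc n choose suc k = n choose k + n choose suc k

choose≡C : ∀ n k → n choose k ≡ n C k
choose≡C n       zero    = refl
choose≡C zero    (suc k) = refl
choose≡C (suc n) (suc k) =
  trans (cong₂ _+_ (choose≡C n k) (choose≡C n (suc k))) (nCk+nC[k+1]≡[n+1]C[k+1] n k)

choose≡0 : ∀ {n k} → n < k → n choose k ≡ 0
choose≡0 {zero}  {suc k} _ = refl
choose≡0 {suc n} {suc k} (s≤s n<k) = cong₂ _+_ (choose≡0 n<k) (choose≡0 (m<n⇒m<1+n n<k))

nchoose1≡n : ∀ n → n choose 1 ≡ n
nchoose1≡n zero    = refl
nchoose1≡n (suc n) = cong suc (nchoose1≡n n)

choose-absorption : ∀ n k → suc k * (suc n choose suc k) ≡ suc n * (n choose k)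
choose-absorption zero    zero    = refl
choose-absorption zero    (suc k) = *-zeroʳ (2 + k)
choose-absorption (suc n) zero    =
  trans (+-identityʳ _) (trans (cong (λ x → 2 + x) (nchoose1≡n n)) (sym (*-identityʳ (2 + n))))
choose-absorption (suc n) (suc k) = begin
  (2 + k) * (a + b)                                       ≡⟨ split k a b ⟩
  a + (1 + k) * a + (2 + k) * b                           ≡⟨ cong₂ (λ x y → a + x + y)
                                                               (choose-absorption n k) (choose-absorption n (suc k)) ⟩
  a + (1 + n) * (n choose k) + (1 + n) * (n choose suc k) ≡⟨ merge n (n choose k) (n choose suc k) ⟩
  (2 + n) * a                                             ∎
  where
  open ≡-Reasoning
  a b : ℕ
  a = suc n choose suc k
  b = suc n choose suc (suc k)
  split : ∀ k a b → (2 + k) * (a + b) ≡ a + (1 + k) * a + (2 + k) * b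
  split = solve-∀
  merge : ∀ n c d → (c + d) + (1 + n) * c + (1 + n) * d ≡ (2 + n) * (c + d)
  merge = solve-∀

pascal-difference : ∀ n i → + (n choose suc i) ≡ + (suc n choose suc i) - + (n choose i)
pascal-difference n i = sym (a+b-a≡b (+ (n choose i)) (+ (n choose suc i)))
  where
  a+b-a≡b : ∀ a b → (a ℤ.+ b) - a ≡ b
  a+b-a≡b = ℤ-Ring.solve-∀

-- `_≡_[mod m ]` unfolds to a divisibility statement about `∣ a - b ∣`, from which Agda
-- cannot infer `a` and `b`; this record wrapper keeps them as indices.
module ModularCongruence (m : ℕ) where

  infix 4 _≈_
  record _≈_ (a b : ℤ) : Set where
    constructor mod
    field unmod : a ≡ b [mod m ]
  open _≈_ public

  private
    m∣-diff : ∀ {a b} → a ≈ b → + m ℤ.∣ a - b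
    m∣-diff h = ℤ.∣ᵤ⇒∣ (unmod h)

    diff-∣ : ∀ {a b} → + m ℤ.∣ a - b → a ≈ b
    diff-∣ h = mod (ℤ.∣⇒∣ᵤ h)

    +-diff : ∀ a b c d → (a ℤ.+ c) - (b ℤ.+ d) ≡ (a - b) ℤ.+ (c - d)
    +-diff = ℤ-Ring.solve-∀

    neg-diff : ∀ a b → (- a) - (- b) ≡ - (a - b)
    neg-diff = ℤ-Ring.solve-∀

    swap-diff : ∀ a b → b - a ≡ - (a - b)
    swap-diff = ℤ-Ring.solve-∀

    chain-diff : ∀ a b c → a - c ≡ (a - b) ℤ.+ (b - c)
    chain-diff = ℤ-Ring.solve-∀

  ≈-reflexive : ∀ {a b} → a ≡ b → a ≈ b
  ≈-reflexive {a} refl = mod (subst (λ x → m ∣ℕ ℤ.∣ x ∣) (sym (ℤ.+-inverseʳ a)) (m ∣0))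

  ≈-refl : ∀ {a} → a ≈ a
  ≈-refl = ≈-reflexive refl

  ≈-sym : ∀ {a b} → a ≈ b → b ≈ a
  ≈-sym {a} {b} h = diff-∣ (subst (+ m ℤ.∣_) (sym (swap-diff a b)) (ℤ.∣m⇒∣-m (m∣-diff h)))

  ≈-trans : ∀ {a b c} → a ≈ b → b ≈ c → a ≈ c
  ≈-trans {a} {b} {c} h h′ =
    diff-∣ (subst (+ m ℤ.∣_) (sym (chain-diff a b c)) (ℤ.∣m∣n⇒∣m+n (m∣-diff h) (m∣-diff h′)))

  +-cong : ∀ {a b c d} → a ≈ b → c ≈ d → a ℤ.+ c ≈ b ℤ.+ d
  +-cong {a} {b} {c} {d} h h′ =
    diff-∣ (subst (+ m ℤ.∣_) (sym (+-diff a b c d)) (ℤ.∣m∣n⇒∣m+n (m∣-diff h) (m∣-diff h′)))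

  -‿cong : ∀ {a b} → a ≈ b → - a ≈ - b
  -‿cong {a} {b} h = diff-∣ (subst (+ m ℤ.∣_) (sym (neg-diff a b)) (ℤ.∣m⇒∣-m (m∣-diff h)))

  ≈-isEquivalence : IsEquivalence _≈_
  ≈-isEquivalence = record { refl = ≈-refl ; sym = ≈-sym ; trans = ≈-trans }

  ≈-setoid : Setoid _ _
  ≈-setoid = record { isEquivalence = ≈-isEquivalence }

  ∣⇒≈0 : ∀ {x} → m ∣ℕ x → + x ≈ + 0
  ∣⇒≈0 {x} m∣x = mod (subst (m ∣ℕ_) (sym (+-identityʳ x)) m∣x)

≡[mod]⇒∣∸ : ∀ {n a b} → a ≤ b → (+ a) ≡ (+ b) [mod n ] → n ∣ℕ b ∸ a
≡[mod]⇒∣∸ {n} {a} {b} a≤b = subst (n ∣ℕ_) (trans (cong ℤ.∣_∣ (ℤ.m-n≡m⊖n a b)) (ℤ.∣⊖∣-≤ a≤b))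

module ChooseModPeriod {m M K : ℕ} (m∣MC[1+j] : ∀ j → j < K → m ∣ℕ M choose suc j) where
  open ModularCongruence m

  choose-periodic : ∀ n j → j ≤ K → + ((n + M) choose j) ≈ + (n choose j)
  choose-periodic zero    zero    _   = ≈-refl
  choose-periodic zero    (suc j) j<K = ∣⇒≈0 (m∣MC[1+j] j j<K)
  choose-periodic (suc n) zero    _   = ≈-refl
  choose-periodic (suc n) (suc j) j<K =
    +-cong (choose-periodic n j (≤-trans (n≤1+n j) j<K)) (choose-periodic n (suc j) j<K)

  choose-periodic-* : ∀ q n j → j ≤ K → + ((n + q * M) choose j) ≈ + (n choose j)
  choose-periodic-* zero    n j _   = ≈-reflexive (cong (λ x → + (x choose j)) (+-identityʳ n))
  choose-periodic-* (suc q) n j j≤K = ≈-trans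
    (≈-reflexive (cong (λ x → + (x choose j)) (x+[y+z]≡[x+z]+y n M (q * M))))
    (≈-trans (choose-periodic (n + q * M) j j≤K) (choose-periodic-* q n j j≤K))
    where
    x+[y+z]≡[x+z]+y : ∀ x y z → x + (y + z) ≡ (x + z) + y
    x+[y+z]≡[x+z]+y = solve-∀

  choose-periodic-∣ : ∀ {a b} j → a ≤ b → M ∣ℕ b ∸ a → j ≤ K → + (b choose j) ≈ + (a choose j)
  choose-periodic-∣ {a} {b} j a≤b (divides q b∸a≡qM) j≤K =
    subst (λ x → + (x choose j) ≈ + (a choose j)) a+qM≡b (choose-periodic-* q a j j≤K)
    where
    a+qM≡b : a + q * M ≡ b
    a+qM≡b = trans (cong (λ x → a + x) (sym b∸a≡qM)) (m+[n∸m]≡n a≤b)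

  choose-≡[mod] : ∀ d d′ j → (+ d) ≡ (+ d′) [mod M ] → j ≤ K → + (d choose j) ≈ + (d′ choose j)
  choose-≡[mod] d d′ j d≡d′ j≤K with ≤-total d d′
  ... | inj₁ d≤d′ = ≈-sym (choose-periodic-∣ j d≤d′ (≡[mod]⇒∣∸ d≤d′ d≡d′) j≤K)
  ... | inj₂ d′≤d = choose-periodic-∣ j d′≤d (≡[mod]⇒∣∸ d′≤d d′≡d) j≤K
    where
    module Mod-M = ModularCongruence M
    d′≡d : (+ d′) ≡ (+ d) [mod M ]
    d′≡d = Mod-M.unmod (Mod-M.≈-sym (Mod-M.mod {+ d} {+ d′} d≡d′))

  choose-vanishes-after-period : ∀ t j → t < j → j ≤ K → + ((M + t) choose j) ≈ + 0
  choose-vanishes-after-period t j t<j j≤K = begin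
    + ((M + t) choose j) ≡⟨ cong (λ x → + (x choose j)) (+-comm M t) ⟩
    + ((t + M) choose j) ≈⟨ choose-periodic t j j≤K ⟩
    + (t choose j)       ≡⟨ cong +_ (choose≡0 t<j) ⟩
    + 0                  ∎
    where open import Relation.Binary.Reasoning.Setoid ≈-setoid

  choose-reflect : ∀ i x j → j ≤ K → x + suc i ≡ M + j →
                   + (x choose j) ≈ ℤ.-1ℤ ℤ.^ j ℤ.* + (i choose j)
  choose-reflect i       x zero    _   _  = ≈-refl
  choose-reflect zero    x (suc j) j<K x+1≡M+1+j = begin
    + (x choose suc j)                  ≡⟨ cong (λ y → + (y choose suc j)) x≡j+M ⟩
    + ((j + M) choose suc j)            ≈⟨ choose-periodic j (suc j) j<K ⟩
    + (j choose suc j)                  ≡⟨ cong +_ (choose≡0 (n<1+n j)) ⟩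
    + 0                                 ≡⟨ ℤ.*-zeroʳ (ℤ.-1ℤ ℤ.^ suc j) ⟨
    ℤ.-1ℤ ℤ.^ suc j ℤ.* + 0             ∎
    where
    open import Relation.Binary.Reasoning.Setoid ≈-setoid
    x≡j+M : x ≡ j + M
    x≡j+M = suc-injective
      (trans (+-comm 1 x) (trans x+1≡M+1+j (trans (+-suc M j) (cong suc (+-comm M j)))))
  choose-reflect (suc i) x (suc j) j<K x+2+i≡M+1+j = begin
    + (x choose suc j)
      ≡⟨ pascal-difference x j ⟩
    + (suc x choose suc j) - + (x choose j)
      ≈⟨ +-cong (choose-reflect i (suc x) (suc j) j<K eq₁)
                (-‿cong (choose-reflect i x j (≤-trans (n≤1+n j) j<K) eq₂)) ⟩
    s (suc j) ℤ.* + (i choose suc j) - s j ℤ.* + (i choose j)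
      ≡⟨ sign-pascal (s j) (+ (i choose j)) (+ (i choose suc j)) ⟩
    s (suc j) ℤ.* + (suc i choose suc j)
      ∎
    where
    open import Relation.Binary.Reasoning.Setoid ≈-setoid
    s : ℕ → ℤ
    s n = ℤ.-1ℤ ℤ.^ n
    sign-pascal : ∀ s a b → (ℤ.-1ℤ ℤ.* s) ℤ.* b - s ℤ.* a ≡ (ℤ.-1ℤ ℤ.* s) ℤ.* (a ℤ.+ b)
    sign-pascal = ℤ-Ring.solve-∀
    eq₁ : suc x + suc i ≡ M + suc j
    eq₁ = trans (sym (+-suc x (suc i))) x+2+i≡M+1+j
    eq₂ : x + suc i ≡ M + j
    eq₂ = suc-injective (trans (sym (+-suc x (suc i))) (trans x+2+i≡M+1+j (+-suc M j)))

module _ {m : ℕ} where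
  open ModularCongruence m

  choose-alternating : ∀ n i → (∀ j → j < i → m ∣ℕ suc n choose suc j) →
                       + (n choose i) ≈ ℤ.-1ℤ ℤ.^ i
  choose-alternating n zero    _        = ≈-refl
  choose-alternating n (suc i) m∣choose = begin
    + (n choose suc i)                      ≡⟨ pascal-difference n i ⟩
    + (suc n choose suc i) - + (n choose i) ≈⟨ +-cong (∣⇒≈0 (m∣choose i ≤-refl))
                                                (-‿cong (choose-alternating n i λ j j<i → m∣choose j (m<n⇒m<1+n j<i))) ⟩
    + 0 - ℤ.-1ℤ ℤ.^ i                       ≡⟨ negate (ℤ.-1ℤ ℤ.^ i) ⟩
    ℤ.-1ℤ ℤ.^ suc i                         ∎
    where
    open import Relation.Binary.Reasoning.Setoid ≈-setoid
    negate : ∀ s → + 0 - s ≡ ℤ.-1ℤ ℤ.* s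
    negate = ℤ-Ring.solve-∀

vanishing-run-shrinks : ∀ {m j} d → (∀ i → i ≤ suc j → m ∣ℕ (d + i) choose suc (suc j)) →
                        ∀ i → i ≤ j → m ∣ℕ (d + i) choose suc j
vanishing-run-shrinks {m} {j} d m∣run i i≤j =
  ∣m+n∣m⇒∣n (subst (m ∣ℕ_) (+-comm ((d + i) choose suc j) _) m∣pascal-sum) (m∣run i (m≤n⇒m≤1+n i≤j))
  where
  m∣pascal-sum : m ∣ℕ (d + i) choose suc j + (d + i) choose suc (suc j)
  m∣pascal-sum = subst (λ y → m ∣ℕ y choose suc (suc j)) (+-suc d i) (m∣run (suc i) (s≤s i≤j))

vanishing-run⇒∣choose : ∀ {m k} d → (∀ i → i ≤ k → m ∣ℕ (d + i) choose suc k) →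
                        ∀ j → j ≤ k → m ∣ℕ d choose suc j
vanishing-run⇒∣choose {m} d m∣run j j≤k =
  subst (λ y → m ∣ℕ y choose suc j) (+-identityʳ d) (shrink (≤⇒≤′ j≤k) m∣run 0 z≤n)
  where
  shrink : ∀ {j k} → j ≤′ k → (∀ i → i ≤ k → m ∣ℕ (d + i) choose suc k) →
           ∀ i → i ≤ j → m ∣ℕ (d + i) choose suc j
  shrink ≤′-refl        run = run
  shrink (≤′-step j≤′k) run = shrink j≤′k (vanishing-run-shrinks d run)

∣-1^n∣≡1 : ∀ n → ℤ.∣ ℤ.-1ℤ ℤ.^ n ∣ ≡ 1
∣-1^n∣≡1 zero    = refl
∣-1^n∣≡1 (suc n) = trans (ℤ.abs-* ℤ.-1ℤ (ℤ.-1ℤ ℤ.^ n)) (trans (+-identityʳ _) (∣-1^n∣≡1 n))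

^-monoʳ-∣ : ∀ m {n o} → n ≤ o → m ^ n ∣ℕ m ^ o
^-monoʳ-∣ m {n} {o} n≤o = subst (λ t → m ^ n ∣ℕ m ^ t) (m+[n∸m]≡n n≤o)
  (divides (m ^ (o ∸ n)) (trans (^-distribˡ-+-* m n (o ∸ n)) (*-comm (m ^ n) (m ^ (o ∸ n)))))

module _ {p : ℕ} (p-prime : Prime p) where

  private instance
    p≢0 : NonZero p
    p≢0 = prime⇒nonZero p-prime

  p≢1 : p ≢ 1
  p≢1 = nonTrivial⇒≢1 {{prime⇒nonTrivial p-prime}}

  p^a∣m*n∧p∤n⇒p^a∣m : ∀ a {m n} → p ^ a ∣ℕ m * n → p ∤ n → p ^ a ∣ℕ m
  p^a∣m*n∧p∤n⇒p^a∣m zero    {m}     _       _   = 1∣ m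
  p^a∣m*n∧p∤n⇒p^a∣m (suc a) {m} {n} p^[1+a]∣m*n p∤n
    with euclidsLemma m n p-prime (∣-trans (m∣m*n (p ^ a)) p^[1+a]∣m*n)
  ... | inj₂ p∣n = contradiction p∣n p∤n
  ... | inj₁ (divides q refl) = subst (p * p ^ a ∣ℕ_) (*-comm p q) (*-monoʳ-∣ p p^a∣q)
    where
    p^a∣q : p ^ a ∣ℕ q
    p^a∣q = p^a∣m*n∧p∤n⇒p^a∣m a
      (*-cancelˡ-∣ p (subst (p * p ^ a ∣ℕ_) (q*p*n≡p*[q*n] q p n) p^[1+a]∣m*n)) p∤n
      where
      q*p*n≡p*[q*n] : ∀ q p n → q * p * n ≡ p * (q * n)
      q*p*n≡p*[q*n] = solve-∀

  p^[e+r]∣j*x∧p^[1+e]∤j⇒p^r∣x : ∀ e r {j x} → p ^ (e + r) ∣ℕ j * x → p ^ suc e ∤ j → p ^ r ∣ℕ x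
  p^[e+r]∣j*x∧p^[1+e]∤j⇒p^r∣x e zero    {x = x} _ _ = 1∣ x
  p^[e+r]∣j*x∧p^[1+e]∤j⇒p^r∣x e (suc r) {j} p^[e+1+r]∣j*x p^[1+e]∤j
    with p^[e+r]∣j*x∧p^[1+e]∤j⇒p^r∣x e r
           (∣-trans (^-monoʳ-∣ p (+-monoʳ-≤ e (n≤1+n r))) p^[e+1+r]∣j*x) p^[1+e]∤j
  ... | divides y refl with p ∣? y
  ...   | yes (divides z refl) = divides z (*-assoc z p (p ^ r))
  ...   | no p∤y = contradiction (p^a∣m*n∧p∤n⇒p^a∣m (suc e) p^[1+e]∣j*y p∤y) p^[1+e]∤j
    where
    instance
      p^r≢0 : NonZero (p ^ r)
      p^r≢0 = m^n≢0 p r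
    p^[1+e]∣j*y : p ^ suc e ∣ℕ j * y
    p^[1+e]∣j*y = *-cancelʳ-∣ (p ^ r) (subst₂ _∣ℕ_
      (trans (cong (p ^_) (+-suc e r)) (^-distribˡ-+-* p (suc e) r)) (sym (*-assoc j y (p ^ r))) p^[e+1+r]∣j*x)

  p^[e+r]∣n⇒p^r∣nC[1+j] : ∀ e r {n} j → p ^ (e + r) ∣ℕ n → suc j < p ^ suc e →
                          p ^ r ∣ℕ n choose suc j
  p^[e+r]∣n⇒p^r∣nC[1+j] e r {zero}  j _          _            = (p ^ r) ∣0
  p^[e+r]∣n⇒p^r∣nC[1+j] e r {suc n} j p^[e+r]∣n 1+j<p^[1+e] =
    p^[e+r]∣j*x∧p^[1+e]∤j⇒p^r∣x e r
      (subst (p ^ (e + r) ∣ℕ_) (sym (choose-absorption n j)) (∣m⇒∣m*n (n choose j) p^[e+r]∣n))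
      (>⇒∤ 1+j<p^[1+e])

  -- For 0 < j < p^a, p divides C(n + 1, j), so Pascal's rule gives C(n, i) ≡ (-1)^i mod p.
  p^a∣1+n⇒p∤nC[p^a-1] : ∀ a {n} → p ^ a ∣ℕ suc n → p ∤ n choose pred (p ^ a)
  p^a∣1+n⇒p∤nC[p^a-1] zero    _ p∣1 = p≢1 (∣1⇒≡1 p∣1)
  p^a∣1+n⇒p∤nC[p^a-1] (suc a) {n} p^[1+a]∣1+n p∣C = p≢1 (∣1⇒≡1 p∣1)
    where
    open ModularCongruence p
    instance
      p^[1+a]≢0 : NonZero (p ^ suc a)
      p^[1+a]≢0 = m^n≢0 p (suc a)
    i : ℕ
    i = pred (p ^ suc a)
    C≈±1 : + (n choose i) ≈ ℤ.-1ℤ ℤ.^ i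
    C≈±1 = choose-alternating n i λ j j<i → ∣-trans (m∣m*n 1)
      (p^[e+r]∣n⇒p^r∣nC[1+j] a 1 j (subst (λ t → p ^ t ∣ℕ suc n) (+-comm 1 a) p^[1+a]∣1+n)
        (subst (suc j <_) (suc-pred (p ^ suc a)) (s≤s j<i)))
    p∣1 : p ∣ℕ 1
    p∣1 = subst (p ∣ℕ_) (trans (cong ℤ.∣_∣ (ℤ.+-identityʳ (ℤ.-1ℤ ℤ.^ i))) (∣-1^n∣≡1 i))
                (unmod (≈-trans (≈-sym C≈±1) (∣⇒≈0 p∣C)))

  p^a∣d⇒p^[a+r]∣d : ∀ a r {d} → p ^ a ∣ℕ d → p ^ r ∣ℕ d choose p ^ a → p ^ (a + r) ∣ℕ d
  p^a∣d⇒p^[a+r]∣d a r {zero}  _ _ = (p ^ (a + r)) ∣0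
  p^a∣d⇒p^[a+r]∣d a r {suc n} (divides w 1+n≡w*p^a) p^r∣C =
    subst₂ _∣ℕ_ (sym (^-distribˡ-+-* p a r)) (trans (*-comm (p ^ a) w) (sym 1+n≡w*p^a))
      (*-monoʳ-∣ (p ^ a) p^r∣w)
    where
    open ≡-Reasoning
    instance
      p^a≢0 : NonZero (p ^ a)
      p^a≢0 = m^n≢0 p a
    Y : ℕ
    Y = n choose pred (p ^ a)
    C≡w*Y : suc n choose p ^ a ≡ w * Y
    C≡w*Y = *-cancelˡ-≡ _ _ (p ^ a) (begin
      p ^ a * (suc n choose p ^ a) ≡⟨ subst (λ t → t * (suc n choose t) ≡ suc n * Y)
                                            (suc-pred (p ^ a)) (choose-absorption n (pred (p ^ a))) ⟩
      suc n * Y                    ≡⟨ cong (_* Y) 1+n≡w*p^a ⟩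
      w * p ^ a * Y                ≡⟨ x*y*z≡y*[x*z] w (p ^ a) Y ⟩
      p ^ a * (w * Y)              ∎)
      where
      x*y*z≡y*[x*z] : ∀ x y z → x * y * z ≡ y * (x * z)
      x*y*z≡y*[x*z] = solve-∀
    p^r∣w : p ^ r ∣ℕ w
    p^r∣w = p^a∣m*n∧p∤n⇒p^a∣m r (subst (p ^ r ∣ℕ_) C≡w*Y p^r∣C)
              (p^a∣1+n⇒p∤nC[p^a-1] a (divides w 1+n≡w*p^a))

  p^[1+r]∣dCp^a⇒p^[e+1+r]∣d : ∀ e r {d} → (∀ a → a ≤ e → p ^ suc r ∣ℕ d choose p ^ a) → p ^ (e + suc r) ∣ℕ d
  p^[1+r]∣dCp^a⇒p^[e+1+r]∣d zero    r {d} p^[1+r]∣C = p^a∣d⇒p^[a+r]∣d 0 (suc r) (1∣ d) (p^[1+r]∣C 0 z≤n)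
  p^[1+r]∣dCp^a⇒p^[e+1+r]∣d (suc e) r {d} p^[1+r]∣C = p^a∣d⇒p^[a+r]∣d (suc e) (suc r)
    (∣-trans (^-monoʳ-∣ p (subst (suc e ≤_) (sym (+-suc e r)) (s≤s (m≤m+n e r))))
             (p^[1+r]∣dCp^a⇒p^[e+1+r]∣d e r (λ a a≤e → p^[1+r]∣C a (m≤n⇒m≤1+n a≤e))))
    (p^[1+r]∣C (suc e) ≤-refl)

module PrimePowerPeriod (k e p : ℕ) (p-prime : Prime p)
                        (p^e≤1+k : p ^ e ≤ suc k) (1+k<p^[1+e] : suc k < p ^ suc e) (r : ℕ) where

  private instance
    p≢0 : NonZero p
    p≢0 = prime⇒nonZero p-prime

  M m : ℕ
  M = p ^ (e + suc r)
  m = p ^ suc r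

  open ModularCongruence m

  m∣MC[1+j] : ∀ j → j < suc k → m ∣ℕ M choose suc j
  m∣MC[1+j] j j<1+k = p^[e+r]∣n⇒p^r∣nC[1+j] p-prime e (suc r) j ∣-refl (≤-<-trans j<1+k 1+k<p^[1+e])

  open ChooseModPeriod {M = M} m∣MC[1+j]

  +choose≡+C : ∀ n → + (n choose suc k) ≡ + (n C suc k)
  +choose≡+C n = cong +_ (choose≡C n (suc k))

  periodicity : (d d′ : ℕ) → (+ d) ≡ (+ d′) [mod M ] → (+ (d C suc k)) ≡ (+ (d′ C suc k)) [mod m ]
  periodicity d d′ d≡d′ =
    unmod (subst₂ _≈_ (+choose≡+C d) (+choose≡+C d′) (choose-≡[mod] d d′ (suc k) d≡d′ ≤-refl))

  reflection : (i : ℕ) → i ≤ M + k →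
               (+ ((M + k ∸ i) C suc k)) ≡ ℤ.-1ℤ ℤ.^ suc k ℤ.* (+ (i C suc k)) [mod m ]
  reflection i i≤M+k = unmod (subst₂ _≈_ (+choose≡+C (M + k ∸ i)) (cong (ℤ.-1ℤ ℤ.^ suc k ℤ.*_) (+choose≡+C i))
    (choose-reflect i (M + k ∸ i) (suc k) ≤-refl sum≡M+1+k))
    where
    sum≡M+1+k : M + k ∸ i + suc i ≡ M + suc k
    sum≡M+1+k = trans (+-suc _ i) (trans (cong suc (m∸n+n≡m i≤M+k)) (sym (+-suc M k)))

  vanishing-at-period : (d : ℕ) → M ≤ d → d ≤ M + k → (+ (d C suc k)) ≡ (+ 0) [mod m ]
  vanishing-at-period d M≤d d≤M+k with d ∸ M | m+[n∸m]≡n M≤d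
  ... | t | refl = unmod (subst (_≈ + 0) (+choose≡+C (M + t))
    (choose-vanishes-after-period t (suc k) (s≤s (+-cancelˡ-≤ M t k d≤M+k)) ≤-refl))

  vanishing-run⇒M∣ : (d : ℕ) → ((i : ℕ) → i ≤ k → (+ ((d + i) C suc k)) ≡ (+ 0) [mod m ]) → M ∣ℕ d
  vanishing-run⇒M∣ d run = p^[1+r]∣dCp^a⇒p^[e+1+r]∣d p-prime e r m∣dCp^a
    where
    m∣run : ∀ i → i ≤ k → m ∣ℕ (d + i) choose suc k
    m∣run i i≤k = subst (m ∣ℕ_) (trans (+-identityʳ _) (sym (choose≡C (d + i) (suc k)))) (run i i≤k)
    m∣dCp^a : ∀ a → a ≤ e → m ∣ℕ d choose p ^ a
    m∣dCp^a a a≤e = subst (λ j → m ∣ℕ d choose j) (suc-pred (p ^ a))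
      (vanishing-run⇒∣choose d m∣run (pred (p ^ a))
        (≤-pred (subst (_≤ suc k) (sym (suc-pred (p ^ a))) (≤-trans (^-monoʳ-≤ p a≤e) p^e≤1+k))))
      where instance
      p^a≢0 : NonZero (p ^ a)
      p^a≢0 = m^n≢0 p a

  no-longer-vanishing-run : (d : ℕ) → ¬ ((i : ℕ) → i ≤ suc k → (+ ((d + i) C suc k)) ≡ (+ 0) [mod m ])
  no-longer-vanishing-run d run = p≢1 p-prime (∣1⇒≡1 (∣-trans p∣M M∣1))
    where
    p∣M : p ∣ℕ M
    p∣M = subst (λ t → p ∣ℕ p ^ t) (sym (+-suc e r)) (m∣m*n (p ^ (e + r)))
    M∣1+d : M ∣ℕ suc d
    M∣1+d = vanishing-run⇒M∣ (suc d) λ i i≤k →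
      subst (λ n → (+ (n C suc k)) ≡ (+ 0) [mod m ]) (+-suc d i) (run (suc i) (s≤s i≤k))
    M∣1 : M ∣ℕ 1
    M∣1 = ∣m+n∣m⇒∣n (subst (M ∣ℕ_) (+-comm 1 d) M∣1+d)
                    (vanishing-run⇒M∣ d λ i i≤k → run i (m≤n⇒m≤1+n i≤k))

lemma3p2 : (k e p : ℕ) → Prime p → p ^ e ≤ suc k → suc k < p ^ (suc e) →
    (r : ℕ) → 1 ≤ r →
      ((d d′ : ℕ) → (+ d) ≡ (+ d′) [mod p ^ (e + r) ] →
          (+ (d C suc k)) ≡ (+ (d′ C suc k)) [mod p ^ r ])
    × ((i : ℕ) → i ≤ p ^ (e + r) + k →
          (+ ((p ^ (e + r) + k ∸ i) C suc k))
            ≡ ((- (+ 1)) ^ℤ (suc k)) *ℤ (+ (i C suc k)) [mod p ^ r ])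
    × ((d : ℕ) → p ^ (e + r) ≤ d → d ≤ p ^ (e + r) + k →
          (+ (d C suc k)) ≡ (+ 0) [mod p ^ r ])
    × ((d : ℕ) → suc k ≤ d →
          ((i : ℕ) → i ≤ k → (+ ((d + i) C suc k)) ≡ (+ 0) [mod p ^ r ]) →
          (p ^ (e + r)) ∣ℕ d)
    × ((d : ℕ) →
          ¬ ((i : ℕ) → i ≤ suc k → (+ ((d + i) C suc k)) ≡ (+ 0) [mod p ^ r ]))
lemma3p2 k e p p-prime p^e≤1+k 1+k<p^[1+e] zero    ()
lemma3p2 k e p p-prime p^e≤1+k 1+k<p^[1+e] (suc r) _ =
  periodicity , reflection , vanishing-at-period , (λ d _ → vanishing-run⇒M∣ d) , no-longer-vanishing-run
  where open PrimePowerPeriod k e p p-prime p^e≤1+k 1+k<p^[1+e] r
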